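{- Let $n\ge 3$. The cycle $C_n$ is a square if and only if $n$ is even. Further, for $n$ even, the square root is unique up to labeling: every partially labeled graph $H$ with $HH\cong C_n$ is a path on $n/2+1$ vertices whose labeled vertices are exactly its two endpoints.
   Context: All graphs are finite and simple. A partially labeled graph is a graph $H$ together with an injective map $\theta: L\to V(H)$, $L\subseteq\mathbb{N}$, whose image $\theta(L)$ is nonempty and a proper subset of $V(H)$; vertices in $\theta(L)$ are labeled. The square $HH$ is obtained from two disjoint copies of $H$ by identifying each labeled vertex $\theta(\ell)$ of the first copy with $\theta(\ell)$ of the second copy (keeping all edges, merging double edges). A graph $G$ is a square if $G\cong HH$ for some partially labeled graph $H$, called a square root of $G$. -}

module Defs where

open import Data.Nat using (ℕ; zero; suc; _≡ᵇ_)
open import Data.Bool using (Bool; true; false; _∧_; _∨_; not)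
open import Data.Bool.Properties using (∨-comm)
open import Data.Fin using (Fin; toℕ)
open import Data.Maybe using (Maybe; just)
open import Data.Product using (Σ; _×_; _,_; ∃; ∃-syntax; proj₁; proj₂)
open import Data.Sum using (_⊎_)
open import Relation.Binary.PropositionalEquality using (_≡_; _≢_; refl; cong; cong₂)
open import Function.Bundles using (_⇔_; _↔_; Inverse)
open import Function.Definitions using (Surjective)

record Graph : Set where
  field
    size   : ℕ
    adj    : Fin size → Fin size → Bool
    sym    : ∀ i j → adj i j ≡ adj j i
    irrefl : ∀ i → adj i i ≡ false
open Graph public

GraphIso : Graph → Graph → Set
GraphIso G G' = Σ (Fin (size G) ↔ Fin (size G')) λ φ →
  ∀ i j → adj G i j ≡ adj G' (Inverse.to φ i) (Inverse.to φ j)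

≡ᵇ-sym : ∀ m n → (m ≡ᵇ n) ≡ (n ≡ᵇ m)
≡ᵇ-sym zero zero = refl
≡ᵇ-sym zero (suc n) = refl
≡ᵇ-sym (suc m) zero = refl
≡ᵇ-sym (suc m) (suc n) = ≡ᵇ-sym m n

≡ᵇ-refl : ∀ m → (m ≡ᵇ m) ≡ true
≡ᵇ-refl zero = refl
≡ᵇ-refl (suc m) = ≡ᵇ-refl m

suc-≡ᵇ : ∀ m → (suc m ≡ᵇ m) ≡ false
suc-≡ᵇ zero = refl
suc-≡ᵇ (suc m) = suc-≡ᵇ m

cycStep : (n : ℕ) → Fin n → Fin n → Bool
cycStep n i j = (suc (toℕ i) ≡ᵇ toℕ j) ∨ ((toℕ j ≡ᵇ 0) ∧ (suc (toℕ i) ≡ᵇ n))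

cycAdj : (n : ℕ) → Fin n → Fin n → Bool
cycAdj n i j = not (toℕ i ≡ᵇ toℕ j) ∧ (cycStep n i j ∨ cycStep n j i)

Cycle : ℕ → Graph
Cycle n = record
  { size = n
  ; adj = cycAdj n
  ; sym = λ i j → cong₂ _∧_ (cong not (≡ᵇ-sym (toℕ i) (toℕ j))) (∨-comm (cycStep n i j) (cycStep n j i))
  ; irrefl = λ i → cong (λ b → not b ∧ (cycStep n i i ∨ cycStep n i i)) (≡ᵇ-refl (toℕ i))
  }

pathAdj : (m : ℕ) → Fin m → Fin m → Bool
pathAdj m i j = (suc (toℕ i) ≡ᵇ toℕ j) ∨ (suc (toℕ j) ≡ᵇ toℕ i)

Path : ℕ → Graph
Path m = record
  { size = m
  ; adj = pathAdj m
  ; sym = λ i j → ∨-comm (suc (toℕ i) ≡ᵇ toℕ j) (suc (toℕ j) ≡ᵇ toℕ i)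
  ; irrefl = λ i → cong (λ b → b ∨ b) (suc-≡ᵇ (toℕ i))
  }

-- Partially labeled graphs.
-- The label map θ : L → V(H), L ⊆ ℕ, is encoded as a partial map
-- θ : ℕ → Maybe V(H), with L = {ℓ | θ ℓ is defined}.

record PLGraph : Set where
  field
    graph    : Graph
    θ        : ℕ → Maybe (Fin (size graph))
    θ-inj    : ∀ ℓ ℓ' v → θ ℓ ≡ just v → θ ℓ' ≡ just v → ℓ ≡ ℓ'
    nonempty : ∃[ ℓ ] ∃[ v ] (θ ℓ ≡ just v)
    proper   : ∃[ v ] (∀ ℓ → θ ℓ ≢ just v)
open PLGraph public

Labeled : (H : PLGraph) → Fin (size (graph H)) → Set
Labeled H v = ∃[ ℓ ] (θ H ℓ ≡ just v)

-- The square HH.  Its vertices are the classes of Bool × V(H) (copy, vertex)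
-- under the identification (b , v) ~ (c , v) for labeled v.

CopyVertex : PLGraph → Set
CopyVertex H = Bool × Fin (size (graph H))

Ident : (H : PLGraph) → CopyVertex H → CopyVertex H → Set
Ident H x y = (x ≡ y) ⊎ ((proj₂ x ≡ proj₂ y) × Labeled H (proj₂ x))

-- classes [x], [y] adjacent in HH iff some representatives are adjacent
-- within the same copy of H (double edges merged)
SqAdj : (H : PLGraph) → CopyVertex H → CopyVertex H → Set
SqAdj H x y = ∃[ x' ] ∃[ y' ]
  ((Ident H x x') × (Ident H y y') × (proj₁ x' ≡ proj₁ y')
   × (adj (graph H) (proj₂ x') (proj₂ y') ≡ true))

-- HH ≅ G: a surjection from Bool × V(H) onto V(G) whose fibres are exactly
-- the ∼-classes (i.e. a bijection from the quotient) and which preserves and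
-- reflects adjacency.
SquareIso : PLGraph → Graph → Set
SquareIso H G = Σ (CopyVertex H → Fin (size G)) λ f →
  Surjective _≡_ _≡_ f
  × (∀ x y → (f x ≡ f y) ⇔ Ident H x y)
  × (∀ x y → (adj G (f x) (f y) ≡ true) ⇔ SqAdj H x y)

IsSquare : Graph → Set
IsSquare G = ∃[ H ] SquareIso H G

IsEndLabeledPath : PLGraph → ℕ → Set
IsEndLabeledPath H m = Σ (GraphIso (graph H) (Path m)) λ φ →
  ∀ v → Labeled H v ⇔ ((toℕ (Inverse.to (proj₁ φ) v) ≡ 0) ⊎ (suc (toℕ (Inverse.to (proj₁ φ) v)) ≡ m))

{-# OPTIONS --safe #-}
-- Exchanging the two copies of a square root H induces an involutive automorphism σ of
-- G = HH whose fixed points are the images of the labeled vertices and which maps no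
-- vertex to a neighbour. Conversely H is recovered from σ, its vertices being the
-- σ-orbits, so two square roots of G inducing the same σ are isomorphic as partially
-- labeled graphs.
--
-- An automorphism of C_n is determined by the images of two adjacent vertices. After a
-- rotation moving a labeled vertex to 0, σ fixes 0 and is not the identity (some vertex
-- is unlabeled), so σ is the reflection k ↦ -k. For n = 2j + 1 this reflection maps
-- j + 1 to its neighbour j, hence n = 2j. Finally, the path 0, …, j labeled at both ends
-- is a square root of C_2j whose involution is that same reflection (one copy lies on
-- 0, …, j, the other on its mirror image), so every square root is isomorphic to it.
module Submission where

open import Defs hiding (sym)
open import Data.Bool using (Bool; true; false; not; T; _∧_)
import Data.Bool.Properties as Bool
open import Data.Bool.Properties
  using (T-≡; T-∧; T-∨; T-not-≡; ¬-not; not-¬; not-involutive; ⇔→≡)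
open import Data.Empty using (⊥-elim)
open import Data.Fin using (Fin; toℕ; fromℕ; fromℕ<; inject₁; inject≤; lower₁; opposite)
  renaming (zero to fzero; suc to fsuc)
open import Data.Fin.Properties
  using ( toℕ-injective; toℕ<n; toℕ-fromℕ; toℕ-fromℕ<; toℕ-inject₁; toℕ-inject≤
        ; fromℕ≢inject₁; inject₁-injective; inject≤-injective; inject₁-lower₁
        ; opposite-prop; opposite-involutive)
open import Data.Maybe using (Maybe; just; nothing)
open import Data.Nat
  using (ℕ; zero; suc; _≡ᵇ_; _+_; _*_; _∸_; _/_; _≤_; _<_; z≤n; s≤s; s≤s⁻¹; s<s⁻¹)
open import Data.Nat.Divisibility using (_∣_; divides)
open import Data.Nat.DivMod using (m*n/n≡m)
open import Data.Nat.Properties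
  using ( _≟_; _≤?_; ≡ᵇ⇒≡; ≡⇒≡ᵇ; suc-injective; +-comm; +-suc; +-identityʳ; *-comm
        ; ≤-reflexive; ≤-trans; ≤-antisym; <-irrefl; <-trans; ≤-<-trans
        ; <⇒≤; <⇒≱; ≤⇒≯; ≰⇒>; ≤∧≢⇒<; 1+n≰n; n<1+n; m≤m+n; +-monoʳ-≤
        ; +-∸-assoc; m+n∸n≡m; ∸-monoʳ-≤; ∸-monoʳ-<; ∸-cancelˡ-≡)
open import Data.Product using (Σ; Σ-syntax; ∃-syntax; _×_; _,_; proj₁; proj₂)
open import Data.Sum as Sum using (_⊎_; inj₁; inj₂; [_,_])
open import Function.Base using (_∘_; id)
open import Function.Bundles using (_⇔_; _↔_; Inverse; Injection; Equivalence; mk⇔; mk↔ₛ′; mk⤖)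
open import Function.Definitions using (Injective; Surjective)
open import Function.Properties.Bijection using (⤖⇒↔)
open import Function.Properties.Equivalence using () renaming (trans to ⇔-trans; sym to ⇔-sym)
open import Function.Properties.Inverse using (↔-refl; ↔-trans; ↔⇒↣)
open import Relation.Binary.PropositionalEquality
  using (_≡_; _≢_; refl; sym; trans; cong; cong₂; subst; subst₂; module ≡-Reasoning)
open import Relation.Nullary using (¬_; yes; no; contradiction)

open Inverse using (to; from; strictlyInverseˡ)

Adjacent : (G : Graph) → Fin (size G) → Fin (size G) → Set
Adjacent G u v = adj G u v ≡ true

GraphIso-refl : ∀ {G} → GraphIso G G
GraphIso-refl = ↔-refl , λ _ _ → refl

GraphIso-trans : ∀ {G₁ G₂ G₃} → GraphIso G₁ G₂ → GraphIso G₂ G₃ → GraphIso G₁ G₃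
GraphIso-trans (φ , φ-adj) (ψ , ψ-adj) = ↔-trans φ ψ , λ u v → trans (φ-adj u v) (ψ-adj _ _)

LabeledIso : PLGraph → PLGraph → Set
LabeledIso H H′ = Σ (GraphIso (graph H) (graph H′)) λ φ →
  ∀ v → Labeled H v ⇔ Labeled H′ (to (proj₁ φ) v)

SquareIso-transport : ∀ {H G G′} → SquareIso H G → GraphIso G G′ → SquareIso H G′
SquareIso-transport {H} {G} {G′} (f , f-surjective , f-ident , f-adj) (φ , φ-adj) =
  to φ ∘ f , surjective , ident , adjacent
  where
  surjective : Surjective _≡_ _≡_ (to φ ∘ f)
  surjective y = proj₁ (f-surjective (from φ y)) ,
    λ z≡x → trans (cong (to φ) (proj₂ (f-surjective (from φ y)) z≡x)) (strictlyInverseˡ φ y)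
  ident : ∀ x y → (to φ (f x) ≡ to φ (f y)) ⇔ Ident H x y
  ident x y = ⇔-trans (mk⇔ (Injection.injective (↔⇒↣ φ)) (cong (to φ))) (f-ident x y)
  adjacent : ∀ x y → Adjacent G′ (to φ (f x)) (to φ (f y)) ⇔ SqAdj H x y
  adjacent x y = subst (λ b → (b ≡ true) ⇔ SqAdj H x y) (φ-adj (f x) (f y)) (f-adj x y)

flipCopy : ∀ {A : Set} → Bool × A → Bool × A
flipCopy (b , v) = not b , v

flipCopy-involutive : ∀ {A : Set} (x : Bool × A) → flipCopy (flipCopy x) ≡ x
flipCopy-involutive (b , v) = cong (_, v) (not-involutive b)

Ident-sym : ∀ {H x y} → Ident H x y → Ident H y x
Ident-sym (inj₁ refl)       = inj₁ refl
Ident-sym (inj₂ (refl , ℓ)) = inj₂ (refl , ℓ)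

Ident-proj₂ : ∀ {H x y} → Ident H x y → proj₂ x ≡ proj₂ y
Ident-proj₂ (inj₁ refl)     = refl
Ident-proj₂ (inj₂ (e , _)) = e

Ident-flipCopy : ∀ {H x y} → Ident H x y → Ident H (flipCopy x) (flipCopy y)
Ident-flipCopy (inj₁ refl) = inj₁ refl
Ident-flipCopy (inj₂ e)    = inj₂ e

SqAdj-flipCopy : ∀ {H x y} → SqAdj H x y → SqAdj H (flipCopy x) (flipCopy y)
SqAdj-flipCopy {H} (x′ , y′ , x∼x′ , y∼y′ , same , a) =
  flipCopy x′ , flipCopy y′ , Ident-flipCopy {H} x∼x′ , Ident-flipCopy {H} y∼y′ , cong not same , a

SqAdj-sym : ∀ {H x y} → SqAdj H x y → SqAdj H y x
SqAdj-sym {H} (x′ , y′ , x∼x′ , y∼y′ , same , a) =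
  y′ , x′ , y∼y′ , x∼x′ , sym same , trans (Graph.sym (graph H) _ _) a

SqAdj-sameCopy : ∀ {H} b {v w} → Adjacent (graph H) v w → SqAdj H (b , v) (b , w)
SqAdj-sameCopy b a = (b , _) , (b , _) , inj₁ refl , inj₁ refl , refl , a

SqAdj⇒adj : ∀ {H x y} → SqAdj H x y → Adjacent (graph H) (proj₂ x) (proj₂ y)
SqAdj⇒adj {H} (x′ , y′ , x∼x′ , y∼y′ , _ , a) =
  subst₂ (Adjacent (graph H)) (sym (Ident-proj₂ {H} x∼x′)) (sym (Ident-proj₂ {H} y∼y′)) a

module SquareRoot {H : PLGraph} {G : Graph} (iso : SquareIso H G) where

  private
    f : CopyVertex H → Fin (size G)
    f = proj₁ iso

    f-ident : ∀ x y → (f x ≡ f y) ⇔ Ident H x y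
    f-ident = proj₁ (proj₂ (proj₂ iso))

    f-adj : ∀ x y → Adjacent G (f x) (f y) ⇔ SqAdj H x y
    f-adj = proj₂ (proj₂ (proj₂ iso))

  preimage : Fin (size G) → CopyVertex H
  preimage y = proj₁ (proj₁ (proj₂ iso) y)

  f-preimage : ∀ y → f (preimage y) ≡ y
  f-preimage y = proj₂ (proj₁ (proj₂ iso) y) refl

  vertexOf : Fin (size G) → Fin (size (graph H))
  vertexOf y = proj₂ (preimage y)

  swap : Fin (size G) → Fin (size G)
  swap y = f (flipCopy (preimage y))

  swap-f : ∀ x → swap (f x) ≡ f (flipCopy x)
  swap-f x = Equivalence.from (f-ident _ _)
    (Ident-flipCopy {H} (Equivalence.to (f-ident _ _) (f-preimage (f x))))

  swap-involutive : ∀ y → swap (swap y) ≡ y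
  swap-involutive y = begin
    swap (f (flipCopy (preimage y)))     ≡⟨ swap-f (flipCopy (preimage y)) ⟩
    f (flipCopy (flipCopy (preimage y))) ≡⟨ cong f (flipCopy-involutive (preimage y)) ⟩
    f (preimage y)                       ≡⟨ f-preimage y ⟩
    y                                    ∎
    where open ≡-Reasoning

  swap-unique : (ρ : Fin (size G) → Fin (size G)) → (∀ x → f (flipCopy x) ≡ ρ (f x)) →
                ∀ y → swap y ≡ ρ y
  swap-unique ρ f-flip y = trans (f-flip (preimage y)) (cong ρ (f-preimage y))

  vertexOf-f : ∀ x → vertexOf (f x) ≡ proj₂ x
  vertexOf-f x = Ident-proj₂ {H} (Equivalence.to (f-ident _ _) (f-preimage (f x)))

  vertexOf-swap : ∀ y → vertexOf (swap y) ≡ vertexOf y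
  vertexOf-swap y = vertexOf-f (flipCopy (preimage y))

  f-vertexOf : ∀ b y → f (b , vertexOf y) ≡ y ⊎ f (b , vertexOf y) ≡ swap y
  f-vertexOf b y with b Bool.≟ proj₁ (preimage y)
  ... | yes refl = inj₁ (f-preimage y)
  ... | no  b≢c  = inj₂ (cong (λ c → f (c , vertexOf y)) (¬-not b≢c))

  SqAdj-preimage : ∀ {y z} → Adjacent G y z → SqAdj H (preimage y) (preimage z)
  SqAdj-preimage {y} {z} a =
    Equivalence.to (f-adj _ _) (subst₂ (Adjacent G) (sym (f-preimage y)) (sym (f-preimage z)) a)

  swap-preserves-adj : ∀ {y z} → Adjacent G y z → Adjacent G (swap y) (swap z)
  swap-preserves-adj a = Equivalence.from (f-adj _ _) (SqAdj-flipCopy {H} (SqAdj-preimage a))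

  swapIso : GraphIso G G
  swapIso = mk↔ₛ′ swap swap swap-involutive swap-involutive , λ y z → ⇔→≡ (mk⇔
    swap-preserves-adj
    (λ a → subst₂ (Adjacent G) (swap-involutive y) (swap-involutive z) (swap-preserves-adj a)))

  swap-nonadjacent : ∀ y → ¬ Adjacent G y (swap y)
  swap-nonadjacent y a = contradiction (trans (sym (Graph.irrefl (graph H) (vertexOf y))) loop) λ ()
    where
    loop : Adjacent (graph H) (vertexOf y) (vertexOf y)
    loop = subst (Adjacent (graph H) (vertexOf y)) (vertexOf-swap y) (SqAdj⇒adj {H} (SqAdj-preimage a))

  vertexOf-labeled⇔fixed : ∀ y → Labeled H (vertexOf y) ⇔ (swap y ≡ y)
  vertexOf-labeled⇔fixed y = mk⇔
    (λ ℓ → trans (Equivalence.from (f-ident _ _) (inj₂ (refl , ℓ))) (f-preimage y))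
    (λ fixed → labeled (Equivalence.to (f-ident _ _) (trans fixed (sym (f-preimage y)))))
    where
    labeled : Ident H (flipCopy (preimage y)) (preimage y) → Labeled H (vertexOf y)
    labeled (inj₁ e)       = contradiction (sym (cong proj₁ e)) (not-¬ refl)
    labeled (inj₂ (_ , ℓ)) = ℓ

  labeled⇔fixed : ∀ b v → Labeled H v ⇔ (swap (f (b , v)) ≡ f (b , v))
  labeled⇔fixed b v = subst (λ u → Labeled H u ⇔ (swap (f (b , v)) ≡ f (b , v))) (vertexOf-f (b , v))
    (vertexOf-labeled⇔fixed (f (b , v)))

  vertexOf-adj⇔ : ∀ y z → Adjacent (graph H) (vertexOf y) (vertexOf z)
                           ⇔ (Adjacent G y z ⊎ Adjacent G y (swap z))
  vertexOf-adj⇔ y z = mk⇔ to′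
    [ (λ a → SqAdj⇒adj {H} (SqAdj-preimage a))
    , (λ a → subst (Adjacent (graph H) (vertexOf y)) (vertexOf-swap z)
               (SqAdj⇒adj {H} (SqAdj-preimage a))) ]
    where
    to′ : Adjacent (graph H) (vertexOf y) (vertexOf z) → Adjacent G y z ⊎ Adjacent G y (swap z)
    to′ a = Sum.map (λ e → subst (Adjacent G y) e y∼fz) (λ e → subst (Adjacent G y) e y∼fz)
                    (f-vertexOf c z)
      where
      c = proj₁ (preimage y)
      y∼fz : Adjacent G y (f (c , vertexOf z))
      y∼fz = subst (λ u → Adjacent G u (f (c , vertexOf z))) (f-preimage y)
               (Equivalence.from (f-adj _ _) (SqAdj-sameCopy {H} c a))

module SameSwap {H H′ : PLGraph} {G : Graph} (iso : SquareIso H G) (iso′ : SquareIso H′ G)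
         (same-swap : ∀ y → SquareRoot.swap {H} {G} iso y ≡ SquareRoot.swap {H′} {G} iso′ y) where

  private
    module R  = SquareRoot {H} {G} iso
    module R′ = SquareRoot {H′} {G} iso′

  vertexOf-f′-vertexOf′ : ∀ b y → R.vertexOf (proj₁ iso′ (b , R′.vertexOf y)) ≡ R.vertexOf y
  vertexOf-f′-vertexOf′ b y with R′.f-vertexOf b y
  ... | inj₁ e = cong R.vertexOf e
  ... | inj₂ e = trans (cong R.vertexOf (trans e (sym (same-swap y)))) (R.vertexOf-swap y)

  adj⇔adj′ : ∀ y z → Adjacent (graph H) (R.vertexOf y) (R.vertexOf z)
                      ⇔ Adjacent (graph H′) (R′.vertexOf y) (R′.vertexOf z)
  adj⇔adj′ y z = ⇔-trans (R.vertexOf-adj⇔ y z) (⇔-sym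
    (subst (λ s → Adjacent (graph H′) (R′.vertexOf y) (R′.vertexOf z)
                  ⇔ (Adjacent G y z ⊎ Adjacent G y s))
      (sym (same-swap z)) (R′.vertexOf-adj⇔ y z)))

  labeled⇔labeled′ : ∀ y → Labeled H (R.vertexOf y) ⇔ Labeled H′ (R′.vertexOf y)
  labeled⇔labeled′ y = ⇔-trans (R.vertexOf-labeled⇔fixed y) (⇔-sym
    (subst (λ s → Labeled H′ (R′.vertexOf y) ⇔ (s ≡ y)) (sym (same-swap y))
      (R′.vertexOf-labeled⇔fixed y)))

square-roots-with-equal-swaps :
  ∀ {H H′ G} (iso : SquareIso H G) (iso′ : SquareIso H′ G) →
  (∀ y → SquareRoot.swap {H} {G} iso y ≡ SquareRoot.swap {H′} {G} iso′ y) → LabeledIso H H′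
square-roots-with-equal-swaps {H} {H′} {G} iso iso′ same-swap = (ψ , ψ-adj) , ψ-labeled
  where
  module R  = SquareRoot {H} {G} iso
  module R′ = SquareRoot {H′} {G} iso′
  module S  = SameSwap {H} {H′} {G} iso iso′ same-swap
  module S′ = SameSwap {H′} {H} {G} iso′ iso (sym ∘ same-swap)

  y⟨_⟩ : Fin (size (graph H)) → Fin (size G)
  y⟨ v ⟩ = proj₁ iso (true , v)

  ψ : Fin (size (graph H)) ↔ Fin (size (graph H′))
  ψ = mk↔ₛ′ (λ v → R′.vertexOf y⟨ v ⟩) (λ w → R.vertexOf (proj₁ iso′ (true , w)))
        (λ w → trans (S′.vertexOf-f′-vertexOf′ true (proj₁ iso′ (true , w)))
                     (R′.vertexOf-f (true , w)))
        (λ v → trans (S.vertexOf-f′-vertexOf′ true y⟨ v ⟩) (R.vertexOf-f (true , v)))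

  ψ-adj : ∀ v w → adj (graph H) v w ≡ adj (graph H′) (to ψ v) (to ψ w)
  ψ-adj v w = trans (sym (cong₂ (adj (graph H)) (R.vertexOf-f (true , v)) (R.vertexOf-f (true , w))))
                    (⇔→≡ (S.adj⇔adj′ y⟨ v ⟩ y⟨ w ⟩))

  ψ-labeled : ∀ v → Labeled H v ⇔ Labeled H′ (to ψ v)
  ψ-labeled v = subst (λ u → Labeled H u ⇔ Labeled H′ (to ψ v)) (R.vertexOf-f (true , v))
                  (S.labeled⇔labeled′ y⟨ v ⟩)

data Step (n : ℕ) : ℕ → ℕ → Set where
  next : ∀ {a} → Step n a (suc a)
  wrap : ∀ {a} → suc a ≡ n → Step n a 0

Step-irrefl : ∀ {n a} → 2 ≤ n → ¬ Step n a a
Step-irrefl (s≤s (s≤s _)) (wrap ())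

Step-functional : ∀ {n a b c} → b < n → c < n → Step n a b → Step n a c → b ≡ c
Step-functional _   _   next     next     = refl
Step-functional b<n _   next     (wrap e) = ⊥-elim (<-irrefl e b<n)
Step-functional _   c<n (wrap e) next     = ⊥-elim (<-irrefl e c<n)
Step-functional _   _   (wrap _) (wrap _) = refl

Step-injective : ∀ {n a b c} → Step n a c → Step n b c → a ≡ b
Step-injective next     next      = refl
Step-injective (wrap e) (wrap e′) = suc-injective (trans e (sym e′))

Edge : ℕ → ℕ → ℕ → Set
Edge n a b = Step n a b ⊎ Step n b a

Edge-irrefl : ∀ {n a} → 2 ≤ n → ¬ Edge n a a
Edge-irrefl 2≤n = [ Step-irrefl 2≤n , Step-irrefl 2≤n ]

T-cycStep⇔Step : ∀ {n} (y z : Fin n) → T (cycStep n y z) ⇔ Step n (toℕ y) (toℕ z)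
T-cycStep⇔Step {n} y z = mk⇔ to′ from′
  where
  a = toℕ y
  b = toℕ z
  to′ : T (cycStep n y z) → Step n a b
  to′ t with Equivalence.to T-∨ t
  ... | inj₁ t′ = subst (Step n a) (≡ᵇ⇒≡ (suc a) b t′) next
  ... | inj₂ t′ with Equivalence.to T-∧ t′
  ...   | b≡0 , 1+a≡n =
    subst (Step n a) (sym (≡ᵇ⇒≡ b 0 b≡0)) (wrap (≡ᵇ⇒≡ (suc a) n 1+a≡n))
  from′ : Step n a b → T (cycStep n y z)
  from′ s = Equivalence.from T-∨ (cases s)
    where
    cases : ∀ {c} → Step n a c → T (suc a ≡ᵇ c) ⊎ T ((c ≡ᵇ 0) ∧ (suc a ≡ᵇ n))
    cases next     = inj₁ (≡⇒≡ᵇ (suc a) (suc a) refl)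
    cases (wrap e) = inj₂ (≡⇒≡ᵇ (suc a) n e)

CycleEdge : ∀ {n} → Fin n → Fin n → Set
CycleEdge {n} y z = Edge n (toℕ y) (toℕ z)

cycAdj⇔CycleEdge : ∀ {n} → 2 ≤ n → (y z : Fin n) → Adjacent (Cycle n) y z ⇔ CycleEdge y z
cycAdj⇔CycleEdge {n} 2≤n y z = mk⇔ to′ from′
  where
  a = toℕ y
  b = toℕ z
  to′ : Adjacent (Cycle n) y z → CycleEdge y z
  to′ e = Sum.map (Equivalence.to (T-cycStep⇔Step y z)) (Equivalence.to (T-cycStep⇔Step z y))
            (Equivalence.to T-∨ (proj₂ (Equivalence.to T-∧ (Equivalence.from T-≡ e))))
  from′ : CycleEdge y z → Adjacent (Cycle n) y z
  from′ e = Equivalence.to T-≡ (Equivalence.from T-∧ (distinct , Equivalence.from T-∨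
              (Sum.map (Equivalence.from (T-cycStep⇔Step y z)) (Equivalence.from (T-cycStep⇔Step z y)) e)))
    where
    distinct : T (not (a ≡ᵇ b))
    distinct = Equivalence.from T-not-≡ (¬-not λ a≡ᵇb →
      Edge-irrefl 2≤n (subst (Edge n a) (sym (≡ᵇ⇒≡ a b (Equivalence.from T-≡ a≡ᵇb))) e))

consecutive-CycleEdge : ∀ {n k} {y z : Fin n} → toℕ y ≡ k → toℕ z ≡ suc k → CycleEdge y z
consecutive-CycleEdge {n} y≡k z≡k+1 = subst₂ (Edge n) (sym y≡k) (sym z≡k+1) (inj₁ next)

at-most-two-neighbours : ∀ {n} {x a b c : Fin n} → CycleEdge x a → CycleEdge x b → CycleEdge x c →
                         a ≢ c → b ≢ c → a ≡ b
at-most-two-neighbours {n} {x} {a} {b} {c} xa xb xc a≢c b≢c = toℕ-injective (neighbours xa xb xc)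
  where
  a≉c : toℕ a ≢ toℕ c
  a≉c = a≢c ∘ toℕ-injective
  b≉c : toℕ b ≢ toℕ c
  b≉c = b≢c ∘ toℕ-injective
  neighbours : Edge n (toℕ x) (toℕ a) → Edge n (toℕ x) (toℕ b) → Edge n (toℕ x) (toℕ c) →
               toℕ a ≡ toℕ b
  neighbours (inj₁ xa) (inj₁ xb) _         = Step-functional (toℕ<n a) (toℕ<n b) xa xb
  neighbours (inj₂ ax) (inj₂ bx) _         = Step-injective ax bx
  neighbours (inj₁ xa) (inj₂ _)  (inj₁ xc) = ⊥-elim (a≉c (Step-functional (toℕ<n a) (toℕ<n c) xa xc))
  neighbours (inj₁ _)  (inj₂ bx) (inj₂ cx) = ⊥-elim (b≉c (Step-injective bx cx))
  neighbours (inj₂ ax) (inj₁ _)  (inj₂ cx) = ⊥-elim (a≉c (Step-injective ax cx))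
  neighbours (inj₂ _)  (inj₁ xb) (inj₁ xc) = ⊥-elim (b≉c (Step-functional (toℕ<n b) (toℕ<n c) xb xc))

neighbours-of-0 : ∀ {n b} → Edge n 0 b → b ≡ 1 ⊎ suc b ≡ n
neighbours-of-0 (inj₁ next)     = inj₁ refl
neighbours-of-0 (inj₁ (wrap e)) = inj₂ e
neighbours-of-0 (inj₂ (wrap e)) = inj₂ e

rotateℕ : ℕ → ℕ → ℕ
rotateℕ m zero    = m
rotateℕ m (suc a) = a

Step-rotateℕ : ∀ {m a b} → Step (suc m) a b → Step (suc m) (rotateℕ m a) (rotateℕ m b)
Step-rotateℕ {a = zero}  next        = wrap refl
Step-rotateℕ {a = suc _} next        = next
Step-rotateℕ {a = zero}  (wrap refl) = wrap refl
Step-rotateℕ {a = suc _} (wrap refl) = next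

Step-rotateℕ⁻¹ : ∀ {m a b} → 1 ≤ m → a < suc m → b < suc m →
                 Step (suc m) (rotateℕ m a) (rotateℕ m b) → Step (suc m) a b
Step-rotateℕ⁻¹ {a = zero}  {zero}  1≤m _ _ s = ⊥-elim (Step-irrefl (s≤s 1≤m) s)
Step-rotateℕ⁻¹ {a = zero}  {suc _} _ _ b<n next = ⊥-elim (1+n≰n (<⇒≤ (s<s⁻¹ b<n)))
Step-rotateℕ⁻¹ {a = zero}  {suc _} _ _ _ (wrap _) = next
Step-rotateℕ⁻¹ {a = suc _} {zero}  _ _ _ next = wrap refl
Step-rotateℕ⁻¹ {a = suc _} {zero}  () _ _ (wrap refl)
Step-rotateℕ⁻¹ {a = suc _} {suc _} _ _ _ next = next
Step-rotateℕ⁻¹ {a = suc _} {suc _} _ a<n _ (wrap e) = ⊥-elim (<-irrefl e a<n)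

reflectℕ : ℕ → ℕ → ℕ
reflectℕ n zero    = zero
reflectℕ n (suc a) = n ∸ suc a

Step-reflectℕ : ∀ {n a b} → b < n → Step n a b → Step n (reflectℕ n b) (reflectℕ n a)
Step-reflectℕ {a = zero}  b<n next = wrap (sym (+-∸-assoc 1 (<⇒≤ b<n)))
Step-reflectℕ {a = suc _} b<n next = subst (Step _ _) (sym (+-∸-assoc 1 (<⇒≤ b<n))) next
Step-reflectℕ {a = zero}  _ (wrap e) = wrap e
Step-reflectℕ {a = suc a} _ (wrap e) =
  subst (Step _ 0) (trans (sym (m+n∸n≡m 1 (suc a))) (cong (_∸ suc a) e)) next

Edge-reflectℕ : ∀ {n a b} → a < n → b < n → Edge n a b → Edge n (reflectℕ n a) (reflectℕ n b)
Edge-reflectℕ _   b<n (inj₁ s) = inj₂ (Step-reflectℕ b<n s)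
Edge-reflectℕ a<n _   (inj₂ s) = inj₁ (Step-reflectℕ a<n s)

rotate : ∀ {m} → Fin (suc m) → Fin (suc m)
rotate {m} fzero = fromℕ m
rotate (fsuc i)  = inject₁ i

toℕ-rotate : ∀ {m} (y : Fin (suc m)) → toℕ (rotate y) ≡ rotateℕ m (toℕ y)
toℕ-rotate {m} fzero = toℕ-fromℕ m
toℕ-rotate (fsuc i)  = toℕ-inject₁ i

rotate-injective : ∀ {m} → Injective _≡_ _≡_ (rotate {m})
rotate-injective {x = fzero}  {fzero}  _ = refl
rotate-injective {x = fzero}  {fsuc _} e = ⊥-elim (fromℕ≢inject₁ e)
rotate-injective {x = fsuc _} {fzero}  e = ⊥-elim (fromℕ≢inject₁ (sym e))
rotate-injective {x = fsuc _} {fsuc _} e = cong fsuc (inject₁-injective e)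

rotate-surjective : ∀ {m} → Surjective _≡_ _≡_ (rotate {m})
rotate-surjective {m} y with m ≟ toℕ y
... | yes m≡y = fzero , λ { refl → toℕ-injective (trans (toℕ-fromℕ m) m≡y) }
... | no  m≢y = fsuc (lower₁ y m≢y) , λ { refl → inject₁-lower₁ y m≢y }

reflect : ∀ {n} → Fin n → Fin n
reflect {suc m} fzero    = fzero
reflect {suc m} (fsuc i) = fsuc (opposite i)

toℕ-reflect : ∀ {n} (y : Fin n) → toℕ (reflect y) ≡ reflectℕ n (toℕ y)
toℕ-reflect {suc m} fzero    = refl
toℕ-reflect {suc m} (fsuc i) = trans (cong suc (opposite-prop i)) (sym (+-∸-assoc 1 (toℕ<n i)))

reflect-involutive : ∀ {n} (y : Fin n) → reflect (reflect y) ≡ y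
reflect-involutive {suc m} fzero    = refl
reflect-involutive {suc m} (fsuc i) = cong fsuc (opposite-involutive i)

reflect-injective : ∀ {n} {y z : Fin n} → reflect y ≡ reflect z → y ≡ z
reflect-injective {y = y} {z} e =
  trans (sym (reflect-involutive y)) (trans (cong reflect e) (reflect-involutive z))

reflect-CycleEdge : ∀ {n} {y z : Fin n} → CycleEdge y z → CycleEdge (reflect y) (reflect z)
reflect-CycleEdge {n} {y} {z} e = subst₂ (Edge n) (sym (toℕ-reflect y)) (sym (toℕ-reflect z))
  (Edge-reflectℕ (toℕ<n y) (toℕ<n z) e)

CycleAut : ℕ → Set
CycleAut n = GraphIso (Cycle n) (Cycle n)

mkCycleAut : ∀ {n} → 2 ≤ n → (φ : Fin n ↔ Fin n) →
           (∀ y z → CycleEdge y z → CycleEdge (to φ y) (to φ z)) →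
           (∀ y z → CycleEdge (to φ y) (to φ z) → CycleEdge y z) → CycleAut n
mkCycleAut {n} 2≤n φ preserves reflects = φ , λ y z → ⇔→≡ (mk⇔
  (λ a → Equivalence.from (edge⇔ _ _) (preserves y z (Equivalence.to (edge⇔ y z) a)))
  (λ a → Equivalence.from (edge⇔ y z) (reflects y z (Equivalence.to (edge⇔ _ _) a))))
  where
  edge⇔ = cycAdj⇔CycleEdge 2≤n

CycleAut-edge : ∀ {n} → 2 ≤ n → (φ : CycleAut n) → ∀ {y z} →
                CycleEdge y z → CycleEdge (to (proj₁ φ) y) (to (proj₁ φ) z)
CycleAut-edge 2≤n (φ , φ-adj) {y} {z} e = Equivalence.to (cycAdj⇔CycleEdge 2≤n _ _)
  (trans (sym (φ-adj y z)) (Equivalence.from (cycAdj⇔CycleEdge 2≤n y z) e))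

rotation : ∀ {m} → CycleAut (suc (suc m))
rotation {m} = mkCycleAut (s≤s (s≤s z≤n)) (⤖⇒↔ (mk⤖ (rotate-injective , rotate-surjective)))
  (λ y z e → subst₂ (Edge _) (sym (toℕ-rotate y)) (sym (toℕ-rotate z))
                (Sum.map Step-rotateℕ Step-rotateℕ e))
  (λ y z e → Sum.map (Step-rotateℕ⁻¹ (s≤s z≤n) (toℕ<n y) (toℕ<n z))
                     (Step-rotateℕ⁻¹ (s≤s z≤n) (toℕ<n z) (toℕ<n y))
                (subst₂ (Edge _) (toℕ-rotate y) (toℕ-rotate z) e))

rotation-to-zero : ∀ {m} (p : Fin (suc (suc m))) →
                   Σ[ φ ∈ CycleAut (suc (suc m)) ] toℕ (to (proj₁ φ) p) ≡ 0
rotation-to-zero {m} p = go (toℕ p) p refl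
  where
  C = Cycle (suc (suc m))
  go : ∀ k p → toℕ p ≡ k → Σ[ φ ∈ CycleAut (suc (suc m)) ] toℕ (to (proj₁ φ) p) ≡ 0
  go zero    p p≡0 = GraphIso-refl {C} , p≡0
  go (suc k) p p≡k+1 with go k (rotate p) (trans (toℕ-rotate p) (cong (rotateℕ (suc m)) p≡k+1))
  ... | φ , φp≡0 = GraphIso-trans {C} {C} {C} rotation φ , φp≡0

reflection : ∀ {n} → 2 ≤ n → CycleAut n
reflection 2≤n = mkCycleAut 2≤n (mk↔ₛ′ reflect reflect reflect-involutive reflect-involutive)
  (λ _ _ → reflect-CycleEdge)
  (λ y z e → subst₂ CycleEdge (reflect-involutive y) (reflect-involutive z) (reflect-CycleEdge e))

AgreeAt : ∀ {n} → (Fin n → Fin n) → (Fin n → Fin n) → ℕ → Set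
AgreeAt {n} φ ψ k = ∀ (y : Fin n) → toℕ y ≡ k → φ y ≡ ψ y

CycleAut-determined-by-0-and-1 :
  ∀ {n} → 2 ≤ n → (φ ψ : CycleAut n) →
  AgreeAt (to (proj₁ φ)) (to (proj₁ ψ)) 0 → AgreeAt (to (proj₁ φ)) (to (proj₁ ψ)) 1 →
  ∀ y → to (proj₁ φ) y ≡ to (proj₁ ψ) y
CycleAut-determined-by-0-and-1 {n} 2≤n φ ψ agree₀ agree₁ y = proj₁ (agree (toℕ y)) y refl
  where
  φ⟨_⟩ ψ⟨_⟩ : Fin n → Fin n
  φ⟨_⟩ = to (proj₁ φ)
  ψ⟨_⟩ = to (proj₁ ψ)

  step : ∀ k → AgreeAt φ⟨_⟩ ψ⟨_⟩ k → AgreeAt φ⟨_⟩ ψ⟨_⟩ (suc k) →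
         AgreeAt φ⟨_⟩ ψ⟨_⟩ (suc (suc k))
  step k agreeₖ agreeₖ₊₁ y₂ y₂≡k+2 =
    at-most-two-neighbours (CycleAut-edge 2≤n φ e₁₂)
      (subst (λ u → CycleEdge u ψ⟨ y₂ ⟩) (sym φy₁≡ψy₁) (CycleAut-edge 2≤n ψ e₁₂))
      (CycleAut-edge 2≤n φ e₁₀)
      (λ e → y₂≢y₀ (Injection.injective (↔⇒↣ (proj₁ φ)) e))
      (λ e → y₂≢y₀ (Injection.injective (↔⇒↣ (proj₁ ψ))
                      (trans e (agreeₖ y₀ (toℕ-fromℕ< _)))))
    where
    k+2<n : suc (suc k) < n
    k+2<n = subst (_< n) y₂≡k+2 (toℕ<n y₂)
    y₁ y₀ : Fin n
    y₁ = fromℕ< (<-trans (n<1+n (suc k)) k+2<n)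
    y₀ = fromℕ< (<-trans (n<1+n k) (<-trans (n<1+n (suc k)) k+2<n))
    φy₁≡ψy₁ : φ⟨ y₁ ⟩ ≡ ψ⟨ y₁ ⟩
    φy₁≡ψy₁ = agreeₖ₊₁ y₁ (toℕ-fromℕ< _)
    e₁₂ : CycleEdge y₁ y₂
    e₁₂ = consecutive-CycleEdge (toℕ-fromℕ< _) y₂≡k+2
    e₁₀ : CycleEdge y₁ y₀
    e₁₀ = Sum.swap (consecutive-CycleEdge (toℕ-fromℕ< _) (toℕ-fromℕ< _))
    y₂≢y₀ : y₂ ≢ y₀
    y₂≢y₀ e = <-irrefl (trans (sym (toℕ-fromℕ< _)) (trans (cong toℕ (sym e)) y₂≡k+2))
                       (<-trans (n<1+n k) (n<1+n (suc k)))

  agree : ∀ k → AgreeAt φ⟨_⟩ ψ⟨_⟩ k × AgreeAt φ⟨_⟩ ψ⟨_⟩ (suc k)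
  agree zero    = agree₀ , agree₁
  agree (suc k) = proj₂ (agree k) , step k (proj₁ (agree k)) (proj₂ (agree k))

CycleAut-fixing-0⇒id⊎reflect : ∀ {n} → 2 ≤ n → (φ : CycleAut n) (z : Fin n) → toℕ z ≡ 0 →
                               to (proj₁ φ) z ≡ z →
                               (∀ y → to (proj₁ φ) y ≡ y) ⊎ (∀ y → to (proj₁ φ) y ≡ reflect y)
CycleAut-fixing-0⇒id⊎reflect {n} 2≤n φ z z≡0 φz≡z =
  Sum.map is-id is-reflect (neighbours-of-0 φy₁-edge)
  where
  φ⟨_⟩ : Fin n → Fin n
  φ⟨_⟩ = to (proj₁ φ)

  y₁ : Fin n
  y₁ = fromℕ< 2≤n

  φy₁-edge : Edge n 0 (toℕ φ⟨ y₁ ⟩)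
  φy₁-edge = subst (λ a → Edge n a (toℕ φ⟨ y₁ ⟩)) (trans (cong toℕ φz≡z) z≡0)
    (CycleAut-edge 2≤n φ (consecutive-CycleEdge z≡0 (toℕ-fromℕ< 2≤n)))

  agree-at-0 : ∀ ψ → ψ z ≡ z → AgreeAt φ⟨_⟩ ψ 0
  agree-at-0 ψ ψz≡z y y≡0 =
    subst (λ u → φ⟨ u ⟩ ≡ ψ u) (toℕ-injective (trans z≡0 (sym y≡0))) (trans φz≡z (sym ψz≡z))

  agree-at-1 : ∀ ψ → toℕ φ⟨ y₁ ⟩ ≡ toℕ (ψ y₁) → AgreeAt φ⟨_⟩ ψ 1
  agree-at-1 ψ same y y≡1 =
    subst (λ u → φ⟨ u ⟩ ≡ ψ u) (toℕ-injective (trans (toℕ-fromℕ< 2≤n) (sym y≡1)))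
      (toℕ-injective same)

  is-id : toℕ φ⟨ y₁ ⟩ ≡ 1 → ∀ y → φ⟨ y ⟩ ≡ y
  is-id φy₁≡1 = CycleAut-determined-by-0-and-1 2≤n φ (GraphIso-refl {Cycle n})
    (agree-at-0 id refl) (agree-at-1 id (trans φy₁≡1 (sym (toℕ-fromℕ< 2≤n))))

  is-reflect : suc (toℕ φ⟨ y₁ ⟩) ≡ n → ∀ y → φ⟨ y ⟩ ≡ reflect y
  is-reflect 1+φy₁≡n = CycleAut-determined-by-0-and-1 2≤n φ (reflection 2≤n)
    (agree-at-0 reflect (toℕ-injective
      (trans (toℕ-reflect z) (trans (cong (reflectℕ n) z≡0) (sym z≡0)))))
    (agree-at-1 reflect (trans (cong (_∸ 1) 1+φy₁≡n)
      (sym (trans (toℕ-reflect y₁) (cong (reflectℕ n) (toℕ-fromℕ< 2≤n))))))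

even⊎odd : ∀ n → ∃[ j ] (n ≡ j + j ⊎ n ≡ suc (j + j))
even⊎odd zero = 0 , inj₁ refl
even⊎odd (suc n) with even⊎odd n
... | j , inj₁ n≡2j   = j , inj₂ (cong suc n≡2j)
... | j , inj₂ n≡2j+1 = suc j , inj₁ (cong suc (trans n≡2j+1 (sym (+-suc j j))))

odd-cycle-reflect-adjacent : ∀ i → Σ[ y ∈ Fin (suc (suc i + suc i)) ] CycleEdge y (reflect y)
odd-cycle-reflect-adjacent i = y , consecutive-CycleEdge (toℕ-fromℕ< i+1<n)
  (trans (toℕ-reflect y) (trans (cong (reflectℕ (suc (suc i + suc i))) (toℕ-fromℕ< i+1<n))
    (m+n∸n≡m (suc (suc i)) (suc i))))
  where
  i+1<n : suc i < suc (suc i + suc i)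
  i+1<n = s≤s (m≤m+n (suc i) (suc i))
  y = fromℕ< i+1<n

cycle-square-root-normalised : ∀ {H n} → 3 ≤ n → SquareIso H (Cycle n) →
  Σ[ iso ∈ SquareIso H (Cycle n) ] (∀ y → SquareRoot.swap {H} {Cycle n} iso y ≡ reflect y)
cycle-square-root-normalised {n = suc zero} (s≤s ())
cycle-square-root-normalised {H} {suc (suc m)} _ iso₀ = iso , swap≡reflect
  where
  n = suc (suc m)
  v₀ : Fin (size (graph H))
  v₀ = proj₁ (proj₂ (nonempty H))
  v₀-labeled : Labeled H v₀
  v₀-labeled = proj₁ (nonempty H) , proj₂ (proj₂ (nonempty H))
  u : Fin (size (graph H))
  u = proj₁ (proper H)
  u-unlabeled : ¬ Labeled H u
  u-unlabeled (ℓ , θℓ≡u) = proj₂ (proper H) ℓ θℓ≡u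

  ρ : Σ[ φ ∈ CycleAut n ] toℕ (to (proj₁ φ) (proj₁ iso₀ (true , v₀))) ≡ 0
  ρ = rotation-to-zero (proj₁ iso₀ (true , v₀))
  iso : SquareIso H (Cycle n)
  iso = SquareIso-transport {H} {Cycle n} {Cycle n} iso₀ (proj₁ ρ)
  module R = SquareRoot {H} {Cycle n} iso

  swap≡reflect : ∀ y → R.swap y ≡ reflect y
  swap≡reflect with CycleAut-fixing-0⇒id⊎reflect (s≤s (s≤s z≤n)) R.swapIso
                      (proj₁ iso (true , v₀)) (proj₂ ρ) (Equivalence.to (R.labeled⇔fixed true v₀) v₀-labeled)
  ... | inj₁ swap≡id      =
    ⊥-elim (u-unlabeled (Equivalence.from (R.labeled⇔fixed true u) (swap≡id _)))
  ... | inj₂ swap≡reflect = swap≡reflect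

IsEnd : ℕ → ℕ → Set
IsEnd j a = a ≡ 0 ⊎ a ≡ j

reflectℕ-fixes-ends : ∀ {j a} → IsEnd j a → reflectℕ (j + j) a ≡ a
reflectℕ-fixes-ends         (inj₁ refl) = refl
reflectℕ-fixes-ends {zero}  (inj₂ refl) = refl
reflectℕ-fixes-ends {suc j} (inj₂ refl) = m+n∸n≡m (suc j) (suc j)

lowerHalf-meets-reflection : ∀ {j a b} → a ≤ j → b ≤ j → a ≡ reflectℕ (j + j) b →
                             a ≡ b × IsEnd j b
lowerHalf-meets-reflection {b = zero} _ _ a≡0 = a≡0 , inj₁ refl
lowerHalf-meets-reflection {j} {a} {suc b} a≤j b<j a≡r = trans a≡j (sym b+1≡j) , inj₂ b+1≡j
  where
  j≤r : j ≤ j + j ∸ suc b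
  j≤r = subst (_≤ j + j ∸ suc b) (m+n∸n≡m j j) (∸-monoʳ-≤ (j + j) b<j)
  a≡j : a ≡ j
  a≡j = ≤-antisym a≤j (subst (j ≤_) (sym a≡r) j≤r)
  b+1≡j : suc b ≡ j
  b+1≡j = ∸-cancelˡ-≡ (≤-trans b<j (m≤m+n j j)) (m≤m+n j j)
            (trans (sym a≡r) (trans a≡j (sym (m+n∸n≡m j j))))

lowerHalf-or-reflected : ∀ j a → a ≤ j ⊎ reflectℕ (j + j) a ≤ j
lowerHalf-or-reflected j zero = inj₁ z≤n
lowerHalf-or-reflected j (suc a) with suc a ≤? j
... | yes a<j = inj₁ a<j
... | no  a≮j =
  inj₂ (subst (j + j ∸ suc a ≤_) (m+n∸n≡m j j) (∸-monoʳ-≤ (j + j) (<⇒≤ (≰⇒> a≮j))))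

1+j<j+j : ∀ {j} → 2 ≤ j → suc j < j + j
1+j<j+j {j} 2≤j = ≤-trans (≤-reflexive (+-comm 2 j)) (+-monoʳ-≤ j 2≤j)

lowerHalf-Edge : ∀ {j a b} → 2 ≤ j → a ≤ j → b ≤ j → Edge (j + j) a b →
                 suc a ≡ b ⊎ suc b ≡ a
lowerHalf-Edge _   _   _   (inj₁ next)     = inj₁ refl
lowerHalf-Edge _   _   _   (inj₂ next)     = inj₂ refl
lowerHalf-Edge 2≤j a≤j _   (inj₁ (wrap e)) = ⊥-elim (<-irrefl e (≤-<-trans (s≤s a≤j) (1+j<j+j 2≤j)))
lowerHalf-Edge 2≤j _   b≤j (inj₂ (wrap e)) = ⊥-elim (<-irrefl e (≤-<-trans (s≤s b≤j) (1+j<j+j 2≤j)))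

Edge-straddling⇒0 : ∀ {n j a r} → a < j → j < r → Edge n a r → a ≡ 0
Edge-straddling⇒0 a<j j<r (inj₁ next)     = ⊥-elim (<⇒≱ a<j (s≤s⁻¹ j<r))
Edge-straddling⇒0 _   ()  (inj₁ (wrap _))
Edge-straddling⇒0 a<j j<r (inj₂ next)     = ⊥-elim (<-irrefl refl (<-trans (<-trans (n<1+n _) a<j) j<r))
Edge-straddling⇒0 _   _   (inj₂ (wrap _)) = refl

Edge-lowerHalf-reflected : ∀ {j a b} → a ≤ j → b ≤ j → Edge (j + j) a (reflectℕ (j + j) b) →
                           IsEnd j a ⊎ IsEnd j b
Edge-lowerHalf-reflected {b = zero} _ _ _ = inj₂ (inj₁ refl)
Edge-lowerHalf-reflected {j} {a} {suc b} a≤j b<j e with a ≟ j | suc b ≟ j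
... | yes a≡j | _         = inj₁ (inj₂ a≡j)
... | no  _   | yes b+1≡j = inj₂ (inj₂ b+1≡j)
... | no  a≢j | no  b+1≢j = inj₁ (inj₁ (Edge-straddling⇒0 (≤∧≢⇒< a≤j a≢j) j<r e))
  where
  j<r : j < j + j ∸ suc b
  j<r = subst (_< j + j ∸ suc b) (m+n∸n≡m j j) (∸-monoʳ-< (≤∧≢⇒< b<j b+1≢j) (m≤m+n j j))

endLabels : (j : ℕ) → ℕ → Maybe (Fin (suc j))
endLabels j 0             = just fzero
endLabels j 1             = just (fromℕ j)
endLabels j (suc (suc _)) = nothing

endLabels-injective : ∀ {j} → 1 ≤ j → ∀ ℓ ℓ′ v →
                      endLabels j ℓ ≡ just v → endLabels j ℓ′ ≡ just v → ℓ ≡ ℓ′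
endLabels-injective _       0 0 _ _    _  = refl
endLabels-injective _       1 1 _ _    _  = refl
endLabels-injective (s≤s _) 0 1 _ refl ()
endLabels-injective (s≤s _) 1 0 _ refl ()

endLabels-proper : ∀ {j} → 2 ≤ j → ∃[ v ] ∀ ℓ → endLabels j ℓ ≢ just v
endLabels-proper (s≤s (s≤s _)) = fsuc fzero , λ { 0 () ; 1 () ; (suc (suc _)) () }

endLabeledPath : (j : ℕ) → 2 ≤ j → PLGraph
endLabeledPath j 2≤j = record
  { graph    = Path (suc j)
  ; θ        = endLabels j
  ; θ-inj    = endLabels-injective (≤-trans (s≤s z≤n) 2≤j)
  ; nonempty = 0 , fzero , refl
  ; proper   = endLabels-proper 2≤j
  }

Labeled-endLabeledPath : ∀ {j} (2≤j : 2 ≤ j) i → Labeled (endLabeledPath j 2≤j) i ⇔ IsEnd j (toℕ i)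
Labeled-endLabeledPath {j} 2≤j i = mk⇔ to′ from′
  where
  to′ : Labeled (endLabeledPath j 2≤j) i → IsEnd j (toℕ i)
  to′ (0 , refl) = inj₁ refl
  to′ (1 , refl) = inj₂ (toℕ-fromℕ j)
  from′ : IsEnd j (toℕ i) → Labeled (endLabeledPath j 2≤j) i
  from′ (inj₁ i≡0) = 0 , cong just (toℕ-injective (sym i≡0))
  from′ (inj₂ i≡j) = 1 , cong just (toℕ-injective (trans (toℕ-fromℕ j) (sym i≡j)))

LabeledIso-endLabeledPath : ∀ {H j} (2≤j : 2 ≤ j) → LabeledIso H (endLabeledPath j 2≤j) →
                            IsEndLabeledPath H (suc j)
LabeledIso-endLabeledPath 2≤j (φ , φ-labeled) = φ , λ v →
  ⇔-trans (φ-labeled v) (⇔-trans (Labeled-endLabeledPath 2≤j _)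
    (mk⇔ (Sum.map₂ (cong suc)) (Sum.map₂ suc-injective)))

module EndLabeledPathSquare (j : ℕ) (2≤j : 2 ≤ j) where

  private
    P : PLGraph
    P = endLabeledPath j 2≤j

    n : ℕ
    n = j + j

    2≤n : 2 ≤ n
    2≤n = ≤-trans 2≤j (m≤m+n j j)

    toℕ≤j : (i : Fin (suc j)) → toℕ i ≤ j
    toℕ≤j i = s≤s⁻¹ (toℕ<n i)

  embed : Fin (suc j) → Fin n
  embed i = inject≤ i (<⇒≤ (1+j<j+j 2≤j))

  toℕ-embed : ∀ i → toℕ (embed i) ≡ toℕ i
  toℕ-embed i = toℕ-inject≤ i _

  embed-fromℕ< : ∀ y (y≤j : toℕ y ≤ j) → embed (fromℕ< (s≤s y≤j)) ≡ y
  embed-fromℕ< y y≤j = toℕ-injective (trans (toℕ-embed _) (toℕ-fromℕ< (s≤s y≤j)))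

  place : CopyVertex P → Fin n
  place (true  , i) = embed i
  place (false , i) = reflect (embed i)

  place-flipCopy : ∀ x → place (flipCopy x) ≡ reflect (place x)
  place-flipCopy (true  , i) = refl
  place-flipCopy (false , i) = sym (reflect-involutive (embed i))

  place-end : ∀ {i} → Labeled P i → ∀ b → place (b , i) ≡ embed i
  place-end     ℓ true  = refl
  place-end {i} ℓ false = toℕ-injective (begin
    toℕ (reflect (embed i))    ≡⟨ toℕ-reflect (embed i) ⟩
    reflectℕ n (toℕ (embed i)) ≡⟨ cong (reflectℕ n) (toℕ-embed i) ⟩
    reflectℕ n (toℕ i)         ≡⟨ reflectℕ-fixes-ends (Equivalence.to (Labeled-endLabeledPath 2≤j i) ℓ) ⟩
    toℕ i                      ≡⟨ toℕ-embed i ⟨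
    toℕ (embed i)              ∎)
    where open ≡-Reasoning

  Ident⇒place≡ : ∀ {x y} → Ident P x y → place x ≡ place y
  Ident⇒place≡ (inj₁ refl) = refl
  Ident⇒place≡ {b , i} {c , .i} (inj₂ (refl , ℓ)) = trans (place-end ℓ b) (sym (place-end ℓ c))

  embed≡reflect⇒Ident : ∀ {i k} → embed i ≡ reflect (embed k) → Ident P (true , i) (false , k)
  embed≡reflect⇒Ident {i} {k} e with lowerHalf-meets-reflection (toℕ≤j i) (toℕ≤j k) values
    where
    values : toℕ i ≡ reflectℕ n (toℕ k)
    values = trans (sym (toℕ-embed i)) (trans (cong toℕ e)
               (trans (toℕ-reflect (embed k)) (cong (reflectℕ n) (toℕ-embed k))))
  ... | i≡k , k-end = inj₂ (toℕ-injective i≡k ,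
          Equivalence.from (Labeled-endLabeledPath 2≤j i) (subst (IsEnd j) (sym i≡k) k-end))

  place≡⇒Ident : ∀ x y → place x ≡ place y → Ident P x y
  place≡⇒Ident (true  , i) (true  , k) e = inj₁ (cong (true ,_) (inject≤-injective _ _ i k e))
  place≡⇒Ident (false , i) (false , k) e =
    inj₁ (cong (false ,_) (inject≤-injective _ _ i k (reflect-injective e)))
  place≡⇒Ident (true  , i) (false , k) e = embed≡reflect⇒Ident e
  place≡⇒Ident (false , i) (true  , k) e = Ident-sym {P} (embed≡reflect⇒Ident (sym e))

  pathAdj⇔CycleEdge : ∀ i k → Adjacent (Path (suc j)) i k ⇔ CycleEdge (embed i) (embed k)
  pathAdj⇔CycleEdge i k = mk⇔ to′ from′
    where
    to′ : Adjacent (Path (suc j)) i k → CycleEdge (embed i) (embed k)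
    to′ a with Equivalence.to T-∨ (Equivalence.from T-≡ a)
    ... | inj₁ t = consecutive-CycleEdge (toℕ-embed i) (trans (toℕ-embed k) (sym (≡ᵇ⇒≡ _ _ t)))
    ... | inj₂ t =
      Sum.swap (consecutive-CycleEdge (toℕ-embed k) (trans (toℕ-embed i) (sym (≡ᵇ⇒≡ _ _ t))))
    from′ : CycleEdge (embed i) (embed k) → Adjacent (Path (suc j)) i k
    from′ e = Equivalence.to T-≡ (Equivalence.from T-∨ (Sum.map (≡⇒≡ᵇ _ _) (≡⇒≡ᵇ _ _)
      (lowerHalf-Edge 2≤j (toℕ≤j i) (toℕ≤j k) (subst₂ (Edge n) (toℕ-embed i) (toℕ-embed k) e))))

  pathAdj⇔sameCopy : ∀ b i k →
                     Adjacent (Path (suc j)) i k ⇔ Adjacent (Cycle n) (place (b , i)) (place (b , k))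
  pathAdj⇔sameCopy true  i k = ⇔-trans (pathAdj⇔CycleEdge i k) (⇔-sym (cycAdj⇔CycleEdge 2≤n _ _))
  pathAdj⇔sameCopy false i k =
    subst (λ a → Adjacent (Path (suc j)) i k ⇔ (a ≡ true)) (proj₂ (reflection 2≤n) (embed i) (embed k))
      (pathAdj⇔sameCopy true i k)

  crossCopy-labeled : ∀ i k → Adjacent (Cycle n) (place (true , i)) (place (false , k)) →
                      Labeled P i ⊎ Labeled P k
  crossCopy-labeled i k a = Sum.map (Equivalence.from (Labeled-endLabeledPath 2≤j i))
                                    (Equivalence.from (Labeled-endLabeledPath 2≤j k))
    (Edge-lowerHalf-reflected (toℕ≤j i) (toℕ≤j k)
      (subst₂ (Edge n) (toℕ-embed i) (trans (toℕ-reflect (embed k)) (cong (reflectℕ n) (toℕ-embed k)))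
        (Equivalence.to (cycAdj⇔CycleEdge 2≤n _ _) a)))

  SqAdj⇒adjacent : ∀ x y → SqAdj P x y → Adjacent (Cycle n) (place x) (place y)
  SqAdj⇒adjacent x y ((d , i) , (.d , k) , x∼x′ , y∼y′ , refl , a) =
    subst₂ (Adjacent (Cycle n)) (sym (Ident⇒place≡ x∼x′)) (sym (Ident⇒place≡ y∼y′))
      (Equivalence.to (pathAdj⇔sameCopy d i k) a)

  adjacent⇒SqAdj : ∀ x y → Adjacent (Cycle n) (place x) (place y) → SqAdj P x y
  adjacent⇒SqAdj (true  , i) (true  , k) a =
    SqAdj-sameCopy {P} true  (Equivalence.from (pathAdj⇔sameCopy true  i k) a)
  adjacent⇒SqAdj (false , i) (false , k) a =
    SqAdj-sameCopy {P} false (Equivalence.from (pathAdj⇔sameCopy false i k) a)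
  adjacent⇒SqAdj (true  , i) (false , k) a with crossCopy-labeled i k a
  ... | inj₁ ℓᵢ = (false , i) , (false , k) , inj₂ (refl , ℓᵢ) , inj₁ refl , refl ,
        Equivalence.from (pathAdj⇔sameCopy false i k)
          (subst (λ u → Adjacent (Cycle n) u (place (false , k)))
            (Ident⇒place≡ {true , i} {false , i} (inj₂ (refl , ℓᵢ))) a)
  ... | inj₂ ℓₖ = (true , i) , (true , k) , inj₁ refl , inj₂ (refl , ℓₖ) , refl ,
        Equivalence.from (pathAdj⇔sameCopy true i k)
          (subst (Adjacent (Cycle n) (place (true , i)))
            (Ident⇒place≡ {false , k} {true , k} (inj₂ (refl , ℓₖ))) a)
  adjacent⇒SqAdj (false , i) (true  , k) a =
    SqAdj-sym {P} (adjacent⇒SqAdj (true , k) (false , i)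
      (trans (Graph.sym (Cycle n) (place (true , k)) (place (false , i))) a))

  place-surjective : Surjective _≡_ _≡_ place
  place-surjective y with lowerHalf-or-reflected j (toℕ y)
  ... | inj₁ y≤j = (true , fromℕ< (s≤s y≤j)) , λ { refl → embed-fromℕ< y y≤j }
  ... | inj₂ ry≤j = (false , fromℕ< (s≤s ry≤j′)) , λ { refl →
          trans (cong reflect (embed-fromℕ< (reflect y) ry≤j′)) (reflect-involutive y) }
    where
    ry≤j′ : toℕ (reflect y) ≤ j
    ry≤j′ = subst (_≤ j) (sym (toℕ-reflect y)) ry≤j

  endLabeledPath-squareIso : SquareIso P (Cycle n)
  endLabeledPath-squareIso = place , place-surjective ,
    (λ x y → mk⇔ (place≡⇒Ident x y) Ident⇒place≡) ,
    (λ x y → mk⇔ (adjacent⇒SqAdj x y) (SqAdj⇒adjacent x y))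

  endLabeledPath-swap : ∀ y → SquareRoot.swap {P} {Cycle n} endLabeledPath-squareIso y ≡ reflect y
  endLabeledPath-swap = SquareRoot.swap-unique {P} {Cycle n} endLabeledPath-squareIso reflect place-flipCopy

3≤j+j⇒2≤j : ∀ {j} → 3 ≤ j + j → 2 ≤ j
3≤j+j⇒2≤j {suc zero}    (s≤s (s≤s ()))
3≤j+j⇒2≤j {suc (suc j)} _ = s≤s (s≤s z≤n)

reflection-swap⇒even : ∀ {H n} → 3 ≤ n → (iso : SquareIso H (Cycle n)) →
                       (∀ y → SquareRoot.swap {H} {Cycle n} iso y ≡ reflect y) → ∃[ j ] n ≡ j + j
reflection-swap⇒even {H} {n} 3≤n iso swap≡reflect with even⊎odd n
... | j     , inj₁ n≡j+j = j , n≡j+j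
... | zero  , inj₂ refl  = ⊥-elim (≤⇒≯ 3≤n (s≤s (s≤s z≤n)))
... | suc i , inj₂ refl  = ⊥-elim (SquareRoot.swap-nonadjacent {H} {Cycle n} iso y
  (subst (Adjacent (Cycle n) y) (sym (swap≡reflect y))
    (Equivalence.from (cycAdj⇔CycleEdge (≤-trans (s≤s (s≤s z≤n)) 3≤n) y (reflect y)) y∼ry)))
  where
  y = proj₁ (odd-cycle-reflect-adjacent i)
  y∼ry = proj₂ (odd-cycle-reflect-adjacent i)

cycle-square-root : ∀ {n} → 3 ≤ n → (H : PLGraph) → SquareIso H (Cycle n) →
                    ∃[ j ] (n ≡ j + j × IsEndLabeledPath H (suc j))
cycle-square-root 3≤n H iso₀ with cycle-square-root-normalised {H} 3≤n iso₀
... | iso , swap≡reflect with reflection-swap⇒even {H} 3≤n iso swap≡reflect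
...   | j , refl = j , refl , LabeledIso-endLabeledPath {H} 2≤j
          (square-roots-with-equal-swaps {H} {endLabeledPath j 2≤j} {Cycle (j + j)}
            iso S.endLabeledPath-squareIso (λ y → trans (swap≡reflect y) (sym (S.endLabeledPath-swap y))))
  where
  2≤j = 3≤j+j⇒2≤j 3≤n
  module S = EndLabeledPathSquare j 2≤j

j*2≡j+j : ∀ j → j * 2 ≡ j + j
j*2≡j+j j = trans (*-comm j 2) (cong (j +_) (+-identityʳ j))

proposition4p1 : (n : ℕ) → 3 ≤ n →
    (IsSquare (Cycle n) ⇔ (2 ∣ n))
    × ((2 ∣ n) → (H : PLGraph) → SquareIso H (Cycle n) → IsEndLabeledPath H (suc (n / 2)))
proposition4p1 n 3≤n = mk⇔ square⇒even even⇒square , λ _ → root-is-path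
  where
  square⇒even : IsSquare (Cycle n) → 2 ∣ n
  square⇒even (H , iso) with cycle-square-root 3≤n H iso
  ... | j , n≡j+j , _ = divides j (trans n≡j+j (sym (j*2≡j+j j)))

  even⇒square : 2 ∣ n → IsSquare (Cycle n)
  even⇒square (divides j n≡j*2) = subst (IsSquare ∘ Cycle) (sym n≡j+j)
    (endLabeledPath j 2≤j , EndLabeledPathSquare.endLabeledPath-squareIso j 2≤j)
    where
    n≡j+j = trans n≡j*2 (j*2≡j+j j)
    2≤j = 3≤j+j⇒2≤j (subst (3 ≤_) n≡j+j 3≤n)

  root-is-path : (H : PLGraph) → SquareIso H (Cycle n) → IsEndLabeledPath H (suc (n / 2))
  root-is-path H iso with cycle-square-root 3≤n H iso
  ... | j , n≡j+j , path = subst (IsEndLabeledPath H ∘ suc) (sym n/2≡j) path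
    where
    n/2≡j : n / 2 ≡ j
    n/2≡j = trans (cong (_/ 2) (trans n≡j+j (sym (j*2≡j+j j)))) (m*n/n≡m j 2)
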